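{- Let $k\ge 2$ and $A=\{1,\dots,k\}$. Any $k$-tree (a tree with vertex set $\{1,\dots,k\}$, viewed as a $(k-2)$-dimensional cycle of the complex $K_k$, with some orientation) is homologous in $K_k$ to an integer linear combination of normed $k$-trees, i.e., of $k$-trees in which the vertex $1$ has order $1$.
   Context: $\Delta_k$ is the simplex whose vertices correspond to the two-element subsets of $\{1,\dots,k\}$; a face is identified with the graph on vertex set $\{1,\dots,k\}$ whose edges are the corresponding subsets. A graph is connected if any two vertices are joined by a chain of its edges. $M_k$ is the subcomplex of faces with non-connected graphs, and $K_k=\Delta_k/M_k$ is the quotient simplicial chain complex (integer coefficients). A tree on $k$ vertices has $k-1$ edges, so it is a $(k-2)$-dimensional face all of whose boundary faces are non-connected; hence (once oriented) it is a cycle of $K_k$. -}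

module Defs where

open import Data.Nat as ℕ using (ℕ; zero; suc; _≤_; _<_)
open import Data.Integer as ℤ using (ℤ; +_; -_)
open import Data.Bool using (Bool; true; false; if_then_else_; _∧_; _∨_)
open import Data.Fin as Fin using (Fin; toℕ)
open import Data.List as List using (List; []; _∷_; _++_; length; concatMap; filter; allFin)
open import Data.List.Relation.Unary.Unique.Propositional using (Unique)
open import Data.Vec as Vec using (Vec; lookup; fromList; _[_]≔_)
open import Data.Product using (Σ; ∃; _×_; _,_; proj₁; proj₂)
open import Data.Sum using (_⊎_)
open import Data.Unit using (⊤)
open import Relation.Nullary using (¬_)
open import Relation.Nullary.Decidable using (⌊_⌋)
open import Relation.Binary.PropositionalEquality using (_≡_)

-- Vertices are Fin k (vertex 1 of the paper is Fin.zero).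
-- The vertices of the simplex Δ_k: two-element subsets {i,j}, i < j,
-- enumerated in a fixed (lexicographic) order; this order fixes the
-- standard orientation of every face.
pairs : (k : ℕ) → List (Fin k × Fin k)
pairs k = concatMap (λ i → List.map (λ j → (i , j)) (filter (λ j → i Fin.<? j) (allFin k))) (allFin k)

E : ℕ → ℕ
E k = length (pairs k)

Edge : ℕ → Set
Edge k = Fin (E k)

ends : {k : ℕ} → Edge k → Fin k × Fin k
ends {k} e = lookup (fromList (pairs k)) e

-- a face of Δ_k = a set of edges (a graph on {1..k}), as a characteristic vector
record Face (k : ℕ) : Set where
  constructor face
  field bits : Vec Bool (E k)
open Face public

In : {k : ℕ} → Face k → Edge k → Set
In s e = lookup (bits s) e ≡ true

Adj : {k : ℕ} → Face k → Fin k → Fin k → Set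
Adj s i j = ∃ λ e → In s e × (ends e ≡ (i , j) ⊎ ends e ≡ (j , i))

data Reach {k : ℕ} (s : Face k) : Fin k → Fin k → Set where
  here : ∀ {i} → Reach s i i
  step : ∀ {i j l} → Adj s i j → Reach s j l → Reach s i l

Connected : {k : ℕ} → Face k → Set
Connected {k} s = (i j : Fin k) → Reach s i j

Walk : {k : ℕ} → Face k → List (Fin k) → Set
Walk s [] = ⊤
Walk s (x ∷ []) = ⊤
Walk s (x ∷ y ∷ r) = Adj s x y × Walk s (y ∷ r)

HasCycle : {k : ℕ} → Face k → Set
HasCycle {k} s = Σ (Fin k) λ v → Σ (List (Fin k)) λ rest →
  (2 ≤ length rest) × Unique (v ∷ rest) × Walk s (v ∷ rest ++ v ∷ [])

Acyclic : {k : ℕ} → Face k → Set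
Acyclic s = ¬ HasCycle s

Tree : {k : ℕ} → Face k → Set
Tree s = Connected s × Acyclic s

ΣFinℕ : {n : ℕ} → (Fin n → ℕ) → ℕ
ΣFinℕ {zero} f = 0
ΣFinℕ {suc n} f = f Fin.zero ℕ.+ ΣFinℕ (λ i → f (Fin.suc i))

ΣFinℤ : {n : ℕ} → (Fin n → ℤ) → ℤ
ΣFinℤ {zero} f = + 0
ΣFinℤ {suc n} f = f Fin.zero ℤ.+ ΣFinℤ (λ i → f (Fin.suc i))

b2n : Bool → ℕ
b2n true = 1
b2n false = 0

size : {k : ℕ} → Face k → ℕ
size s = ΣFinℕ (λ e → b2n (lookup (bits s) e))

degree : {k : ℕ} → Face k → Fin k → ℕ
degree s v = ΣFinℕ (λ e → b2n (lookup (bits s) e ∧ (⌊ proj₁ (ends e) Fin.≟ v ⌋ ∨ ⌊ proj₂ (ends e) Fin.≟ v ⌋)))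

NormedTree : {k : ℕ} → Fin k → Face k → Set
NormedTree v s = Tree s × degree s v ≡ 1

-- Chains of K_k = Δ_k / M_k: a chain is an integer function on faces
-- (the coefficient of each face in its standard orientation); values on
-- non-connected faces (faces of M_k) are irrelevant (quotient).
Chain : ℕ → Set
Chain k = Face k → ℤ

before : {k : ℕ} → Face k → Edge k → ℕ
before s e = ΣFinℕ (λ e' → b2n (lookup (bits s) e' ∧ ⌊ toℕ e' ℕ.<? toℕ e ⌋))

sgn : ℕ → ℤ
sgn n = (- (+ 1)) ℤ.^ n

∂ : {k : ℕ} → Chain k → Chain k
∂ c s = ΣFinℤ (λ e → if lookup (bits s) e then + 0 else sgn (before s e) ℤ.* c (face (bits s [ e ]≔ true)))

δ : {k : ℕ} → Face k → Chain k
δ t s = if ⌊ Vec≟ (bits t) (bits s) ⌋ then + 1 else + 0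
  where open import Data.Vec.Properties using (≡-dec)
        open import Data.Bool.Properties using () renaming (_≟_ to _≟B_)
        Vec≟ = ≡-dec _≟B_

module Submission where

-- Induction on the degree of the vertex 1 (here Fin.zero) in the tree T.  If the degree is 1,
-- T is normed.  Otherwise T has edges 1p and 1q, and adding the edge pq gives a connected
-- graph U with k edges.  Deleting an edge of U off the triangle 1pq disconnects U, because T
-- has no cycle, so modulo M_k the boundary of U is ±T ± T₁ ± T₂ with T₁ = U − 1p and
-- T₂ = U − 1q.  These are again trees, and in them vertex 1 has one edge less.

open import Defs
open import Data.Nat using (ℕ; suc; _∸_)
open import Data.Integer using (ℤ; +_; -_; _*_; _-_)
open import Data.Fin using (zero)
open import Data.Product using (Σ; _×_)
open import Data.Sum using (_⊎_)
open import Relation.Binary.PropositionalEquality using (_≡_; _≢_)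

open import Data.Bool using (Bool; true; false; if_then_else_; _∧_; _∨_)
import Data.Bool.Properties as Boolₚ
open import Data.Empty using (⊥; ⊥-elim)
open import Data.Fin as Fin using (Fin; suc; _≟_)
import Data.Fin.Properties as Finₚ
open import Data.List as List using (List; []; _∷_; _++_; length; allFin; filter; map)
open import Data.List.Membership.Propositional using (_∈_)
open import Data.List.Membership.Propositional.Properties
open import Data.List.Relation.Unary.All as All using (All; []; _∷_)
import Data.List.Relation.Unary.All.Properties as Allₚ
open import Data.List.Relation.Unary.AllPairs as AllPairs using ([]; _∷_)
import Data.List.Relation.Unary.AllPairs.Properties as AllPairsₚ
import Data.List.Relation.Unary.Any as Any
open import Data.List.Relation.Unary.Any.Properties using (lookup-index)
open import Data.List.Relation.Unary.Unique.Propositional using (Unique)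
import Data.List.Relation.Unary.Unique.Propositional.Properties as Uniqueₚ
open import Data.Nat as ℕ using (zero; _≤_; s≤s; z≤n)
import Data.Nat.Properties as ℕₚ
import Data.Nat.Tactic.RingSolver as ℕ-Solver
open import Data.Product as Product using (∃; _,_; proj₁; proj₂)
open import Data.Sum as Sum using (inj₁; inj₂)
open import Data.Vec as Vec using (Vec; lookup; fromList; _[_]≔_)
import Data.Vec.Properties as Vecₚ
open import Function using (_∘_; _$_; id)
open import Relation.Binary using (tri<; tri≈; tri>)
open import Relation.Binary.PropositionalEquality
  using (refl; sym; trans; cong; cong₂; subst; module ≡-Reasoning)
open import Relation.Nullary using (¬_; Dec; yes; no)
open import Relation.Nullary.Decidable using (⌊_⌋; isYes≗does; dec-true; dec-false; decidable-stable)

private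
  variable
    k : ℕ

-- Edges of the complete graph

module _ {A : Set} where

  lookup-fromList : (xs : List A) (i : Fin (length xs)) → lookup (fromList xs) i ≡ List.lookup xs i
  lookup-fromList (x ∷ xs) zero    = refl
  lookup-fromList (x ∷ xs) (suc i) = lookup-fromList xs i

  lookup-injective : {xs : List A} → Unique xs → ∀ i j → List.lookup xs i ≡ List.lookup xs j → i ≡ j
  lookup-injective {x ∷ xs} u        zero    zero    eq = refl
  lookup-injective {x ∷ xs} (x∉ ∷ u) zero    (suc j) eq = ⊥-elim (All.lookup x∉ (∈-lookup j) eq)
  lookup-injective {x ∷ xs} (x∉ ∷ u) (suc i) zero    eq = ⊥-elim (All.lookup x∉ (∈-lookup i) (sym eq))
  lookup-injective {x ∷ xs} (x∉ ∷ u) (suc i) (suc j) eq = cong suc (lookup-injective u i j eq)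

pairsFrom : (k : ℕ) → Fin k → List (Fin k × Fin k)
pairsFrom k i = map (i ,_) (filter (i Fin.<?_) (allFin k))

∈-pairs⁻ : {x : Fin k × Fin k} → x ∈ pairs k → proj₁ x Fin.< proj₂ x
∈-pairs⁻ {k} x∈ with Any.satisfied (∈-concatMap⁻ (pairsFrom k) {xs = allFin k} x∈)
... | i , x∈row with ∈-map⁻ (i ,_) x∈row
... | j , j∈ , refl = proj₂ (∈-filter⁻ (i Fin.<?_) {xs = allFin k} j∈)

∈-pairs⁺ : {i j : Fin k} → i Fin.< j → (i , j) ∈ pairs k
∈-pairs⁺ {k} {i} {j} i<j = ∈-concatMap⁺ (pairsFrom k) {xs = allFin k}
  (Any.map (λ { refl → ∈-map⁺ (i ,_) (∈-filter⁺ (i Fin.<?_) (∈-allFin j) i<j) }) (∈-allFin i))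

pairs-unique : (k : ℕ) → Unique (pairs k)
pairs-unique k = Uniqueₚ.concat⁺
  (Allₚ.map⁺ (All.tabulate λ {i} _ → Uniqueₚ.map⁺ (cong proj₂) (Uniqueₚ.filter⁺ (i Fin.<?_) (Uniqueₚ.allFin⁺ k))))
  (AllPairsₚ.map⁺ (AllPairs.map disjoint (Uniqueₚ.allFin⁺ k)))
  where
  first : ∀ {i x} → x ∈ pairsFrom k i → proj₁ x ≡ i
  first {i} x∈ with ∈-map⁻ (i ,_) x∈
  ... | _ , _ , refl = refl
  disjoint : ∀ {i i′} → i ≢ i′ → ∀ {x} → x ∈ pairsFrom k i × x ∈ pairsFrom k i′ → ⊥
  disjoint i≢i′ (x∈ , x∈′) = i≢i′ (trans (sym (first x∈)) (first x∈′))

ends-< : (e : Edge k) → proj₁ (ends e) Fin.< proj₂ (ends e)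
ends-< {k} e = ∈-pairs⁻ (subst (_∈ pairs k) (sym (lookup-fromList (pairs k) e)) (∈-lookup e))

ends-injective : {e e′ : Edge k} → ends e ≡ ends e′ → e ≡ e′
ends-injective {k} {e} {e′} eq = lookup-injective (pairs-unique k) e e′ (begin
  List.lookup (pairs k) e    ≡⟨ sym (lookup-fromList (pairs k) e) ⟩
  ends e                      ≡⟨ eq ⟩
  ends e′                     ≡⟨ lookup-fromList (pairs k) e′ ⟩
  List.lookup (pairs k) e′   ∎)
  where open ≡-Reasoning

edge-between : {i j : Fin k} → i Fin.< j → ∃ λ (e : Edge k) → ends e ≡ (i , j)
edge-between {k} i<j = let p = ∈-pairs⁺ i<j in
  Any.index p , trans (lookup-fromList (pairs k) (Any.index p)) (sym (lookup-index p))

Links : Edge k → Fin k → Fin k → Set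
Links e i j = ends e ≡ (i , j) ⊎ ends e ≡ (j , i)

edge-linking : {i j : Fin k} → i ≢ j → ∃ λ (e : Edge k) → Links e i j
edge-linking {i = i} {j} i≢j with Finₚ.<-cmp i j
... | tri< i<j _ _ = Product.map₂ inj₁ (edge-between i<j)
... | tri≈ _ i≡j _ = ⊥-elim (i≢j i≡j)
... | tri> _ _ j<i = Product.map₂ inj₂ (edge-between j<i)

module _ {e : Edge k} {a b : Fin k} where

  Links-sym : Links e a b → Links e b a
  Links-sym (inj₁ eq) = inj₂ eq
  Links-sym (inj₂ eq) = inj₁ eq

  Links-endpoint : ∀ {i j} → Links e a b → Links e i j → i ≡ a ⊎ i ≡ b
  Links-endpoint (inj₁ eq) (inj₁ eq′) = inj₁ (cong proj₁ (trans (sym eq′) eq))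
  Links-endpoint (inj₁ eq) (inj₂ eq′) = inj₂ (cong proj₂ (trans (sym eq′) eq))
  Links-endpoint (inj₂ eq) (inj₁ eq′) = inj₂ (cong proj₁ (trans (sym eq′) eq))
  Links-endpoint (inj₂ eq) (inj₂ eq′) = inj₁ (cong proj₂ (trans (sym eq′) eq))

Links-unique : {e e′ : Edge k} {a b : Fin k} → Links e a b → Links e′ a b → e ≡ e′
Links-unique (inj₁ eq) (inj₁ eq′) = ends-injective (trans eq (sym eq′))
Links-unique (inj₂ eq) (inj₂ eq′) = ends-injective (trans eq (sym eq′))
Links-unique {e = e} {e′} (inj₁ eq) (inj₂ eq′) =
  ⊥-elim (Finₚ.<-asym (subst (λ x → proj₁ x Fin.< proj₂ x) eq (ends-< e))
                      (subst (λ x → proj₁ x Fin.< proj₂ x) eq′ (ends-< e′)))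
Links-unique (inj₂ eq) (inj₁ eq′) = sym (Links-unique (inj₁ eq′) (inj₂ eq))

addEdge : Face k → Edge k → Face k
addEdge s e = face (bits s [ e ]≔ true)

removeEdge : Face k → Edge k → Face k
removeEdge s e = face (bits s [ e ]≔ false)

_⊆_ : Face k → Face k → Set
s ⊆ t = ∀ {e} → In s e → In t e

module _ {k : ℕ} (s : Face k) (e : Edge k) where

  ∈-addEdge : In (addEdge s e) e
  ∈-addEdge = Vecₚ.lookup∘update e (bits s) true

  ∈-addEdge⁺ : s ⊆ addEdge s e
  ∈-addEdge⁺ {e′} e′∈ with e′ ≟ e
  ... | yes refl = ∈-addEdge
  ... | no e′≢e  = trans (Vecₚ.lookup∘update′ e′≢e (bits s) true) e′∈

  ∈-addEdge⁻ : ∀ {e′} → In (addEdge s e) e′ → In s e′ ⊎ e′ ≡ e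
  ∈-addEdge⁻ {e′} e′∈ with e′ ≟ e
  ... | yes e′≡e = inj₂ e′≡e
  ... | no e′≢e  = inj₁ (trans (sym (Vecₚ.lookup∘update′ e′≢e (bits s) true)) e′∈)

  ∉-removeEdge : ¬ In (removeEdge s e) e
  ∉-removeEdge e∈ with trans (sym (Vecₚ.lookup∘update e (bits s) false)) e∈
  ... | ()

  ∈-removeEdge⁺ : ∀ {e′} → In s e′ → e′ ≢ e → In (removeEdge s e) e′
  ∈-removeEdge⁺ e′∈ e′≢e = trans (Vecₚ.lookup∘update′ e′≢e (bits s) false) e′∈

  ∈-removeEdge⁻ : ∀ {e′} → In (removeEdge s e) e′ → In s e′ × e′ ≢ e
  ∈-removeEdge⁻ {e′} e′∈ with e′ ≟ e
  ... | yes refl = ⊥-elim (∉-removeEdge e′∈)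
  ... | no e′≢e  = trans (sym (Vecₚ.lookup∘update′ e′≢e (bits s) false)) e′∈ , e′≢e

  removeEdge-⊆ : removeEdge s e ⊆ s
  removeEdge-⊆ e′∈ = proj₁ (∈-removeEdge⁻ e′∈)

  removeEdge-addEdge : ¬ In s e → bits (removeEdge (addEdge s e) e) ≡ bits s
  removeEdge-addEdge e∉ = begin
    (bits s [ e ]≔ true) [ e ]≔ false  ≡⟨ Vecₚ.[]≔-idempotent (bits s) e ⟩
    bits s [ e ]≔ false                ≡⟨ cong (bits s [ e ]≔_) (Boolₚ.¬-not e∉) ⟨
    bits s [ e ]≔ lookup (bits s) e    ≡⟨ Vecₚ.[]≔-lookup (bits s) e ⟩
    bits s                             ∎
    where open ≡-Reasoning

  addEdge-removeEdge : In s e → bits (addEdge (removeEdge s e) e) ≡ bits s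
  addEdge-removeEdge e∈ = begin
    (bits s [ e ]≔ false) [ e ]≔ true  ≡⟨ Vecₚ.[]≔-idempotent (bits s) e ⟩
    bits s [ e ]≔ true                 ≡⟨ cong (bits s [ e ]≔_) e∈ ⟨
    bits s [ e ]≔ lookup (bits s) e    ≡⟨ Vecₚ.[]≔-lookup (bits s) e ⟩
    bits s                             ∎
    where open ≡-Reasoning

removeEdge-mono : {s t : Face k} → s ⊆ t → ∀ e → removeEdge s e ⊆ removeEdge t e
removeEdge-mono {s = s} {t} s⊆t e e′∈ with ∈-removeEdge⁻ s e e′∈
... | e′∈s , e′≢e = ∈-removeEdge⁺ t e (s⊆t e′∈s) e′≢e

-- Paths and cycles

module _ {G : Face k} where

  Adj-sym : ∀ {i j} → Adj G i j → Adj G j i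
  Adj-sym (e , e∈ , lk) = e , e∈ , Links-sym lk

  Reach-trans : ∀ {i j l} → Reach G i j → Reach G j l → Reach G i l
  Reach-trans here       r′ = r′
  Reach-trans (step a r) r′ = step a (Reach-trans r r′)

  Reach-sym : ∀ {i j} → Reach G i j → Reach G j i
  Reach-sym here       = here
  Reach-sym (step a r) = Reach-trans (Reach-sym r) (step (Adj-sym a) here)

  private
    Reach-≡ : ∀ {a b i j} → (a , b) ≡ (i , j) → Reach G a b → Reach G i j
    Reach-≡ refl r = r

  Links-reach : ∀ {e a b i j} → Links e a b → Links e i j → Reach G a b → Reach G i j
  Links-reach (inj₁ eq) (inj₁ eq′) = Reach-≡ (trans (sym eq) eq′)
  Links-reach (inj₁ eq) (inj₂ eq′) = Reach-sym ∘ Reach-≡ (trans (sym eq) eq′)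
  Links-reach (inj₂ eq) (inj₁ eq′) = Reach-≡ (trans (sym eq) eq′) ∘ Reach-sym
  Links-reach (inj₂ eq) (inj₂ eq′) = Reach-sym ∘ Reach-≡ (trans (sym eq) eq′) ∘ Reach-sym

Reach-mono : {G H : Face k} → G ⊆ H → ∀ {i j} → Reach G i j → Reach H i j
Reach-mono G⊆H here                   = here
Reach-mono G⊆H (step (e , e∈ , lk) r) = step (e , G⊆H e∈ , lk) (Reach-mono G⊆H r)

Walk-mono : {G H : Face k} → G ⊆ H → ∀ xs → Walk G xs → Walk H xs
Walk-mono G⊆H []          _                   = _
Walk-mono G⊆H (x ∷ [])    _                   = _
Walk-mono G⊆H (x ∷ y ∷ r) ((e , e∈ , lk) , w) = (e , G⊆H e∈ , lk) , Walk-mono G⊆H (y ∷ r) w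

module _ {G H : Face k} {ex : Edge k} {a b : Fin k} (H⊆G+ex : H ⊆ addEdge G ex) (lk : Links ex a b) where

  Reach-bypass : Reach G a b → ∀ {u w} → Reach H u w → Reach G u w
  Reach-bypass r here = here
  Reach-bypass r (step (e , e∈ , lk′) r′) with ∈-addEdge⁻ G ex (H⊆G+ex e∈)
  ... | inj₁ e∈G  = step (e , e∈G , lk′) (Reach-bypass r r′)
  ... | inj₂ refl = Reach-trans (Links-reach lk lk′ r) (Reach-bypass r r′)

  Reach-addEdge⁻ : ∀ {u w} → Reach H u w → Reach G u w ⊎ Reach G u a ⊎ Reach G u b
  Reach-addEdge⁻ here = inj₁ here
  Reach-addEdge⁻ {u} (step {j = j} (e , e∈ , lk′) r′) with ∈-addEdge⁻ G ex (H⊆G+ex e∈)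
  ... | inj₂ refl = inj₂ (Sum.map (λ { refl → here }) (λ { refl → here }) (Links-endpoint lk lk′))
  ... | inj₁ e∈G  = Sum.map (step a′) (Sum.map (step a′) (step a′)) (Reach-addEdge⁻ r′)
    where
    a′ : Adj G u j
    a′ = e , e∈G , lk′

Redundant : Face k → Edge k → Set
Redundant G e = In G e × Reach (removeEdge G e) (proj₁ (ends e)) (proj₂ (ends e))

redundant : {G : Face k} {e : Edge k} {a b : Fin k} →
            In G e → Links e a b → Reach (removeEdge G e) a b → Redundant G e
redundant e∈ lk r = e∈ , Links-reach lk (inj₁ refl) r

private
  Last : List (Fin k) → Fin k → Set
  Last []           l = ⊥
  Last (x ∷ [])     l = x ≡ l
  Last (_ ∷ y ∷ ys) l = Last (y ∷ ys) l

  Last-split : ∀ {x} y (q : List (Fin k)) → Last (y ∷ q) x → (q ≡ [] × y ≡ x) ⊎ ∃ λ mid → q ≡ mid ++ x ∷ []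
  Last-split y []      refl = inj₁ (refl , refl)
  Last-split y (z ∷ q) lst with Last-split z q lst
  ... | inj₁ (refl , refl) = inj₂ ([] , refl)
  ... | inj₂ (mid , refl)  = inj₂ (z ∷ mid , refl)

  Unique-rotate : ∀ ys (x : Fin k) → Unique (ys ++ x ∷ []) → Unique (x ∷ ys)
  Unique-rotate []       x u        = [] ∷ []
  Unique-rotate (y ∷ ys) x (y∉ ∷ u) with Unique-rotate ys x u | Allₚ.++⁻ ys y∉
  ... | x∉ ∷ u′ | y∉ys , y≢x ∷ [] = ((y≢x ∘ sym) ∷ x∉) ∷ (y∉ys ∷ u′)

  module _ {G : Face k} where

    SimpleWalk : List (Fin k) → Fin k → Set
    SimpleWalk xs l = Unique xs × Walk G xs × Last xs l

    SimpleWalk-drop : ∀ pre {i suf l} → SimpleWalk (pre ++ i ∷ suf) l → SimpleWalk (i ∷ suf) l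
    SimpleWalk-drop []            sw                      = sw
    SimpleWalk-drop (x ∷ [])      (_ ∷ u , (_ , w) , lst) = u , w , lst
    SimpleWalk-drop (x ∷ y ∷ pre) (_ ∷ u , (_ , w) , lst) = SimpleWalk-drop (y ∷ pre) (u , w , lst)

    simplify : ∀ {i l} → Reach G i l → Σ (List (Fin k)) λ ps → SimpleWalk (i ∷ ps) l
    simplify here = [] , ([] ∷ []) , _ , refl
    simplify {i} {l} (step {j = j} a r) with simplify r
    ... | ps , u , w , lst with Any.any? (i ≟_) (j ∷ ps)
    ... | no  i∉ = j ∷ ps , (Allₚ.¬Any⇒All¬ (j ∷ ps) i∉ ∷ u) , (a , w) , lst
    ... | yes i∈ with ∈-∃++ i∈
    ... | pre , suf , eq = suf , SimpleWalk-drop pre (subst (λ xs → SimpleWalk xs l) eq (u , w , lst))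

module _ {G : Face k} where

  Redundant⇒HasCycle : ∀ {e} → Redundant G e → HasCycle G
  Redundant⇒HasCycle {e} (e∈ , r) = close (proj₂ (simplify (Reach-sym r)))
    where
    x y : Fin k
    x = proj₁ (ends e)
    y = proj₂ (ends e)
    close : ∀ {ps} → SimpleWalk {G = removeEdge G e} (y ∷ ps) x → HasCycle G
    close {ps} (u , w , lst) with Last-split {x = x} y ps lst
    ... | inj₁ (refl , y≡x) = ⊥-elim (Finₚ.<-irrefl (sym y≡x) (ends-< {k} e))
    ... | inj₂ ([] , refl) with proj₁ w
    ...   | e′ , e′∈ , lk′ =
      ⊥-elim $ ∉-removeEdge G e (subst (In (removeEdge G e)) (Links-unique {k} (Links-sym lk′) (inj₁ refl)) e′∈)
    close (u , w , lst) | inj₂ (z ∷ mid , refl) =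
      x , y ∷ z ∷ mid , s≤s (s≤s z≤n) , Unique-rotate (y ∷ z ∷ mid) x u ,
      (e , e∈ , inj₁ refl) , Walk-mono (removeEdge-⊆ G e) (y ∷ z ∷ mid ++ x ∷ []) w

  HasCycle⇒Redundant : HasCycle G → ∃ (Redundant G)
  HasCycle⇒Redundant (_ , []     , () , _)
  HasCycle⇒Redundant (_ , _ ∷ [] , s≤s () , _)
  HasCycle⇒Redundant (v , r₁ ∷ r₂ ∷ rs , _ , (v∉ ∷ r₁∉ ∷ _) , ((e , e∈ , lk) , a₁₂ , w)) =
    e , redundant e∈ lk (Reach-sym (step r₁→r₂ (walk⇒reach r₂ rs off-e w)))
    where
    off-e : All (λ x → x ≢ v × x ≢ r₁) (r₂ ∷ rs)
    off-e = All.zipWith (λ (v≢x , r₁≢x) → v≢x ∘ sym , r₁≢x ∘ sym) (All.tail v∉ , r₁∉)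
    avoid : ∀ {x y} → Adj G x y → x ≢ v → x ≢ r₁ → Adj (removeEdge G e) x y
    avoid (e′ , e′∈ , lk′) x≢v x≢r₁ with e′ ≟ e
    ... | no e′≢e  = e′ , ∈-removeEdge⁺ G e e′∈ e′≢e , lk′
    ... | yes refl = ⊥-elim (Sum.[ x≢v , x≢r₁ ] (Links-endpoint lk lk′))
    r₁→r₂ : Adj (removeEdge G e) r₁ r₂
    r₁→r₂ = Adj-sym {G = removeEdge G e} (avoid (Adj-sym {G = G} a₁₂) (All.head (All.tail v∉) ∘ sym) (All.head r₁∉ ∘ sym))
    walk⇒reach : ∀ x q → All (λ x → x ≢ v × x ≢ r₁) (x ∷ q) → Walk G (x ∷ q ++ v ∷ []) →
                 Reach (removeEdge G e) x v
    walk⇒reach x []      ((x≢v , x≢r₁) ∷ []) (a , _) = step (avoid a x≢v x≢r₁) here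
    walk⇒reach x (y ∷ q) ((x≢v , x≢r₁) ∷ off) (a , w) = step (avoid a x≢v x≢r₁) (walk⇒reach y q off w)

Acyclic⇒bridge : {G : Face k} {e : Edge k} {a b : Fin k} →
                 Acyclic G → In G e → Links e a b → ¬ Reach (removeEdge G e) a b
Acyclic⇒bridge acyclic e∈ lk r = acyclic (Redundant⇒HasCycle (redundant e∈ lk r))

-- ℕ addition is opened only inside Counting; everywhere else _+_ is addition on ℤ.
module Counting where
  open import Data.Nat using (_+_)

  ΣFinℕ-cong : {n : ℕ} {f g : Fin n → ℕ} → (∀ i → f i ≡ g i) → ΣFinℕ f ≡ ΣFinℕ g
  ΣFinℕ-cong {zero}  f≗g = refl
  ΣFinℕ-cong {suc n} f≗g = cong₂ _+_ (f≗g zero) (ΣFinℕ-cong (f≗g ∘ suc))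

  ΣFinℕ-update : {n : ℕ} (f g : Fin n → ℕ) (e : Fin n) → (∀ i → i ≢ e → f i ≡ g i) →
                 ΣFinℕ f + g e ≡ ΣFinℕ g + f e
  ΣFinℕ-update {suc n} f g zero f≗g = begin
    f zero + ΣFinℕ (f ∘ suc) + g zero  ≡⟨ cong (λ t → f zero + t + g zero) (ΣFinℕ-cong λ i → f≗g (suc i) λ ()) ⟩
    f zero + ΣFinℕ (g ∘ suc) + g zero  ≡⟨ swap-ends (f zero) (ΣFinℕ (g ∘ suc)) (g zero) ⟩
    g zero + ΣFinℕ (g ∘ suc) + f zero  ∎
    where
    open ≡-Reasoning
    swap-ends : ∀ a t b → a + t + b ≡ b + t + a
    swap-ends = ℕ-Solver.solve-∀
  ΣFinℕ-update {suc n} f g (suc e) f≗g = begin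
    f zero + ΣFinℕ (f ∘ suc) + g (suc e)    ≡⟨ ℕₚ.+-assoc (f zero) _ _ ⟩
    f zero + (ΣFinℕ (f ∘ suc) + g (suc e))  ≡⟨ cong₂ _+_ (f≗g zero λ ()) (ΣFinℕ-update (f ∘ suc) (g ∘ suc) e
                                                          λ i i≢e → f≗g (suc i) (i≢e ∘ Finₚ.suc-injective)) ⟩
    g zero + (ΣFinℕ (g ∘ suc) + f (suc e))  ≡⟨ ℕₚ.+-assoc (g zero) _ _ ⟨
    g zero + ΣFinℕ (g ∘ suc) + f (suc e)    ∎
    where open ≡-Reasoning

  ΣFinℕ-≢0 : {n : ℕ} (f : Fin n → ℕ) → ΣFinℕ f ≢ 0 → ∃ λ i → f i ≢ 0
  ΣFinℕ-≢0 {zero}  f Σ≢0 = ⊥-elim (Σ≢0 refl)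
  ΣFinℕ-≢0 {suc n} f Σ≢0 with f zero ℕ.≟ 0
  ... | no  f0≢0 = zero , f0≢0
  ... | yes f0≡0 = Product.map suc id (ΣFinℕ-≢0 (f ∘ suc) (Σ≢0 ∘ cong₂ _+_ f0≡0))

  ΣFinℕ-[]≔ : (w : Edge k → Bool → ℕ) (v : Vec Bool (E k)) (e : Edge k) (b : Bool) →
              ΣFinℕ (λ i → w i (lookup (v [ e ]≔ b) i)) + w e (lookup v e) ≡ ΣFinℕ (λ i → w i (lookup v i)) + w e b
  ΣFinℕ-[]≔ w v e b =
    trans (ΣFinℕ-update (λ i → w i (lookup (v [ e ]≔ b) i)) (λ i → w i (lookup v i)) e
                        λ i i≢e → cong (w i) (Vecₚ.lookup∘update′ i≢e v b))
          (cong (λ x → _ + w e x) (Vecₚ.lookup∘update e v b))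

  incident : Fin k → Edge k → Bool
  incident r e = ⌊ proj₁ (ends e) ≟ r ⌋ ∨ ⌊ proj₂ (ends e) ≟ r ⌋

  private
    ⌊⌋-true : {A : Set} (a? : Dec A) → A → ⌊ a? ⌋ ≡ true
    ⌊⌋-true a? a = trans (isYes≗does a?) (dec-true a? a)

    ⌊⌋-false : {A : Set} (a? : Dec A) → ¬ A → ⌊ a? ⌋ ≡ false
    ⌊⌋-false a? ¬a = trans (isYes≗does a?) (dec-false a? ¬a)

  module _ {r : Fin k} {e : Edge k} where

    incident-here : proj₁ (ends e) ≡ r → incident r e ≡ true
    incident-here eq = cong (_∨ ⌊ proj₂ (ends e) ≟ r ⌋) (⌊⌋-true (proj₁ (ends e) ≟ r) eq)

    incident-away : ∀ {a b} → Links e a b → a ≢ r → b ≢ r → incident r e ≡ false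
    incident-away lk a≢r b≢r =
      cong₂ _∨_ (⌊⌋-false (proj₁ (ends e) ≟ r) (avoids (inj₁ refl))) (⌊⌋-false (proj₂ (ends e) ≟ r) (avoids (inj₂ refl)))
      where
      avoids : ∀ {i j} → Links e i j → i ≢ r
      avoids lk′ refl = Sum.[ a≢r ∘ sym , b≢r ∘ sym ] (Links-endpoint lk lk′)

    incident⁻ : incident r e ≡ true → proj₁ (ends e) ≡ r ⊎ proj₂ (ends e) ≡ r
    incident⁻ inc with proj₁ (ends e) ≟ r | proj₂ (ends e) ≟ r
    ... | yes eq | _      = inj₁ eq
    ... | no _   | yes eq = inj₂ eq

  module _ {k : ℕ} (s : Face k) (e : Edge k) where
    open ≡-Reasoning

    size-addEdge : ¬ In s e → size (addEdge s e) ≡ suc (size s)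
    size-addEdge e∉ = begin
      size (addEdge s e)                             ≡⟨ ℕₚ.+-identityʳ _ ⟨
      size (addEdge s e) + b2n false                 ≡⟨ cong (λ b → size (addEdge s e) + b2n b) (Boolₚ.¬-not e∉) ⟨
      size (addEdge s e) + b2n (lookup (bits s) e)   ≡⟨ ΣFinℕ-[]≔ {k} (λ _ → b2n) (bits s) e true ⟩
      size s + 1                                     ≡⟨ ℕₚ.+-comm (size s) 1 ⟩
      suc (size s)                                   ∎

    size-removeEdge : In s e → suc (size (removeEdge s e)) ≡ size s
    size-removeEdge e∈ = begin
      suc (size (removeEdge s e))                        ≡⟨ ℕₚ.+-comm 1 _ ⟩
      size (removeEdge s e) + b2n true                   ≡⟨ cong (λ b → size (removeEdge s e) + b2n b) e∈ ⟨
      size (removeEdge s e) + b2n (lookup (bits s) e)    ≡⟨ ΣFinℕ-[]≔ {k} (λ _ → b2n) (bits s) e false ⟩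
      size s + 0                                         ≡⟨ ℕₚ.+-identityʳ _ ⟩
      size s                                             ∎

    degree-addEdge : ∀ {r} → incident r e ≡ false → degree (addEdge s e) r ≡ degree s r
    degree-addEdge {r} away = begin
      degree (addEdge s e) r                                      ≡⟨ ℕₚ.+-identityʳ _ ⟨
      degree (addEdge s e) r + b2n false                          ≡⟨ cong (λ b → degree (addEdge s e) r + b2n b) e∧away ⟨
      degree (addEdge s e) r + b2n (lookup (bits s) e ∧ incident r e)
        ≡⟨ ΣFinℕ-[]≔ {k} (λ i x → b2n (x ∧ incident {k} r i)) (bits s) e true ⟩
      degree s r + b2n (incident r e)                             ≡⟨ cong (λ b → degree s r + b2n b) away ⟩
      degree s r + 0                                              ≡⟨ ℕₚ.+-identityʳ _ ⟩
      degree s r                                                  ∎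
      where
      e∧away : lookup (bits s) e ∧ incident r e ≡ false
      e∧away = trans (cong (lookup (bits s) e ∧_) away) (Boolₚ.∧-zeroʳ _)

    degree-removeEdge : ∀ {r} → In s e → incident r e ≡ true → suc (degree (removeEdge s e) r) ≡ degree s r
    degree-removeEdge {r} e∈ inc = begin
      suc (degree (removeEdge s e) r)                ≡⟨ ℕₚ.+-comm 1 _ ⟩
      degree (removeEdge s e) r + b2n true           ≡⟨ cong₂ (λ b c → degree (removeEdge s e) r + b2n (b ∧ c)) e∈ inc ⟨
      degree (removeEdge s e) r + b2n (lookup (bits s) e ∧ incident r e)
        ≡⟨ ΣFinℕ-[]≔ {k} (λ i x → b2n (x ∧ incident {k} r i)) (bits s) e false ⟩
      degree s r + 0                                 ≡⟨ ℕₚ.+-identityʳ _ ⟩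
      degree s r                                     ∎

  incident-edge : {k : ℕ} (s : Face k) (r : Fin k) → degree s r ≢ 0 →
                  ∃ λ e → In s e × (proj₁ (ends e) ≡ r ⊎ proj₂ (ends e) ≡ r)
  incident-edge {k} s r deg≢0 with ΣFinℕ-≢0 (λ e → b2n (lookup (bits s) e ∧ incident {k} r e)) deg≢0
  ... | e , count≢0 with lookup (bits s) e in e∈ | incident r e in inc
  ... | true  | true  = e , e∈ , incident⁻ inc
  ... | true  | false = ⊥-elim (count≢0 refl)
  ... | false | _     = ⊥-elim (count≢0 refl)

open Counting

-- Chains and the boundary

open import Data.Integer using (_+_)
import Data.Integer.Properties as ℤₚ
import Data.Integer.Tactic.RingSolver as ℤ-Solver
open import Data.Vec.Functional using (updateAt)
open import Data.Vec.Functional.Properties using (updateAt-updates; updateAt-minimal)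
open import Algebra.Properties.CommutativeSemigroup ℤₚ.+-commutativeSemigroup
  using (x∙yz≈y∙xz) renaming (interchange to +-interchange)

i+j≢0⇒i≢0⊎j≢0 : (i j : ℤ) → i + j ≢ + 0 → i ≢ + 0 ⊎ j ≢ + 0
i+j≢0⇒i≢0⊎j≢0 i j i+j≢0 with i Data.Integer.≟ + 0
... | no  i≢0  = inj₁ i≢0
... | yes refl = inj₂ (i+j≢0 ∘ trans (ℤₚ.+-identityˡ j))

i*j≢0⇒j≢0 : (i j : ℤ) → i * j ≢ + 0 → j ≢ + 0
i*j≢0⇒j≢0 i j i*j≢0 j≡0 = i*j≢0 (trans (cong (i *_) j≡0) (ℤₚ.*-zeroʳ i))

sgn-involutive : (m : ℕ) → sgn m * sgn m ≡ + 1
sgn-involutive zero    = refl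
sgn-involutive (suc m) = trans (neg-square (sgn m)) (sgn-involutive m)
  where
  neg-square : ∀ a → (- (+ 1) * a) * (- (+ 1) * a) ≡ a * a
  neg-square = ℤ-Solver.solve-∀

ΣFinℤ-cong : {n : ℕ} {f g : Fin n → ℤ} → (∀ i → f i ≡ g i) → ΣFinℤ f ≡ ΣFinℤ g
ΣFinℤ-cong {zero}  f≗g = refl
ΣFinℤ-cong {suc n} f≗g = cong₂ _+_ (f≗g zero) (ΣFinℤ-cong (f≗g ∘ suc))

ΣFinℤ-zero : {n : ℕ} {f : Fin n → ℤ} → (∀ i → f i ≡ + 0) → ΣFinℤ f ≡ + 0
ΣFinℤ-zero {zero}  f≗0 = refl
ΣFinℤ-zero {suc n} f≗0 = cong₂ _+_ (f≗0 zero) (ΣFinℤ-zero (f≗0 ∘ suc))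

ΣFinℤ-+ : {n : ℕ} (f g : Fin n → ℤ) → ΣFinℤ (λ i → f i + g i) ≡ ΣFinℤ f + ΣFinℤ g
ΣFinℤ-+ {zero}  f g = refl
ΣFinℤ-+ {suc n} f g = trans (cong (λ t → f zero + g zero + t) (ΣFinℤ-+ (f ∘ suc) (g ∘ suc)))
                            (+-interchange (f zero) (g zero) _ _)

ΣFinℤ-pull : {n : ℕ} (f : Fin n → ℤ) (a : Fin n) → ΣFinℤ f ≡ f a + ΣFinℤ (updateAt f a λ _ → + 0)
ΣFinℤ-pull {suc n} f zero    = cong (λ t → f zero + t) (sym (ℤₚ.+-identityˡ _))
ΣFinℤ-pull {suc n} f (suc a) =
  trans (cong (λ t → f zero + t) (ΣFinℤ-pull (f ∘ suc) a)) (x∙yz≈y∙xz (f zero) (f (suc a)) _)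

ΣFinℤ-support₃ : {n : ℕ} (f : Fin n → ℤ) {a b c : Fin n} → b ≢ a → c ≢ a → c ≢ b →
                 (∀ i → i ≢ a → i ≢ b → i ≢ c → f i ≡ + 0) → ΣFinℤ f ≡ f a + (f b + f c)
ΣFinℤ-support₃ f {a} {b} {c} b≢a c≢a c≢b off = begin
  ΣFinℤ f                          ≡⟨ ΣFinℤ-pull f a ⟩
  f a + ΣFinℤ f₁                   ≡⟨ cong (λ t → f a + t) (ΣFinℤ-pull f₁ b) ⟩
  f a + (f₁ b + ΣFinℤ f₂)          ≡⟨ cong (λ t → f a + (f₁ b + t)) (ΣFinℤ-pull f₂ c) ⟩
  f a + (f₁ b + (f₂ c + ΣFinℤ f₃)) ≡⟨ cong (λ t → f a + (f₁ b + (f₂ c + t))) (ΣFinℤ-zero f₃≗0) ⟩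
  f a + (f₁ b + (f₂ c + + 0))      ≡⟨ cong₂ (λ x y → f a + (x + y)) f₁b≡fb (trans (ℤₚ.+-identityʳ _) f₂c≡fc) ⟩
  f a + (f b + f c)                ∎
  where
  open ≡-Reasoning
  f₁ f₂ f₃ : Fin _ → ℤ
  f₁ = updateAt f a λ _ → + 0
  f₂ = updateAt f₁ b λ _ → + 0
  f₃ = updateAt f₂ c λ _ → + 0
  f₁b≡fb : f₁ b ≡ f b
  f₁b≡fb = updateAt-minimal b a f b≢a
  f₂c≡fc : f₂ c ≡ f c
  f₂c≡fc = trans (updateAt-minimal c b f₁ c≢b) (updateAt-minimal c a f c≢a)
  f₃≗0 : ∀ i → f₃ i ≡ + 0
  f₃≗0 i with i ≟ c | i ≟ b | i ≟ a
  ... | yes refl | _        | _        = updateAt-updates c f₂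
  ... | no i≢c   | yes refl | _        = trans (updateAt-minimal i c f₂ i≢c) (updateAt-updates b f₁)
  ... | no i≢c   | no i≢b   | yes refl = trans (updateAt-minimal i c f₂ i≢c)
                                        (trans (updateAt-minimal i b f₁ i≢b) (updateAt-updates a f))
  ... | no i≢c   | no i≢b   | no i≢a   = trans (updateAt-minimal i c f₂ i≢c)
                                        (trans (updateAt-minimal i b f₁ i≢b)
                                        (trans (updateAt-minimal i a f i≢a) (off i i≢a i≢b i≢c)))

module _ {k : ℕ} where

  private
    bits≟ : (u v : Vec Bool (E k)) → Dec (u ≡ v)
    bits≟ = Vecₚ.≡-dec Boolₚ._≟_

  δ-≢ : (t s : Face k) → bits t ≢ bits s → δ t s ≡ + 0
  δ-≢ t s neq with bits≟ (bits t) (bits s)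
  ... | yes eq = ⊥-elim (neq eq)
  ... | no _   = refl

  δ-≢0 : (t s : Face k) → δ t s ≢ + 0 → bits t ≡ bits s
  δ-≢0 t s δ≢0 with bits≟ (bits t) (bits s)
  ... | yes eq = eq
  ... | no _   = ⊥-elim (δ≢0 refl)

  δ-transport : (f : Face k → ℤ) (t s : Face k) → δ t s * f t ≡ δ t s * f s
  δ-transport f t s with bits≟ (bits t) (bits s)
  ... | yes eq = cong (λ v → + 1 * f (face v)) eq
  ... | no _   = refl

  δ-addEdge : (U s : Face k) (e : Edge k) → In U e → ¬ In s e → δ U (addEdge s e) ≡ δ (removeEdge U e) s
  δ-addEdge U s e e∈U e∉s with bits≟ (bits U) (bits (addEdge s e)) | bits≟ (bits (removeEdge U e)) (bits s)
  ... | yes _  | yes _   = refl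
  ... | no _   | no _    = refl
  ... | yes eq | no neq  = ⊥-elim (neq (trans (cong (_[ e ]≔ false) eq) (removeEdge-addEdge s e e∉s)))
  ... | no neq | yes eq  = ⊥-elim (neq (trans (sym (addEdge-removeEdge U e e∈U)) (cong (_[ e ]≔ true) eq)))

  ∂-summand : Chain k → Face k → Edge k → ℤ
  ∂-summand c s e = if lookup (bits s) e then + 0 else sgn (before s e) * c (addEdge s e)

  ∂-+ : (c d : Chain k) (s : Face k) → ∂ (λ t → c t + d t) s ≡ ∂ c s + ∂ d s
  ∂-+ c d s = trans (ΣFinℤ-cong summand-+) (ΣFinℤ-+ (∂-summand c s) (∂-summand d s))
    where
    summand-+ : ∀ e → ∂-summand (λ t → c t + d t) s e ≡ ∂-summand c s e + ∂-summand d s e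
    summand-+ e with lookup (bits s) e
    ... | true  = refl
    ... | false = ℤₚ.*-distribˡ-+ (sgn (before s e)) _ _

  ∂-zero : (s : Face k) → ∂ (λ _ → + 0) s ≡ + 0
  ∂-zero s = ΣFinℤ-zero summand-zero
    where
    summand-zero : ∀ e → ∂-summand (λ _ → + 0) s e ≡ + 0
    summand-zero e with lookup (bits s) e
    ... | true  = refl
    ... | false = ℤₚ.*-zeroʳ (sgn (before s e))

  module _ (U : Face k) (x : ℤ) where

    ∂-summand-face : (e : Edge k) → In U e → (s : Face k) →
      ∂-summand (λ t → x * δ U t) s e ≡ δ (removeEdge U e) s * (sgn (before (removeEdge U e) e) * x)
    ∂-summand-face e e∈U s with lookup (bits s) e in bit
    ... | true  = sym (trans (cong (_* σx) (δ-≢ (removeEdge U e) s U-e≢s)) (ℤₚ.*-zeroˡ σx))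
      where
      σx : ℤ
      σx = sgn (before (removeEdge U e) e) * x
      U-e≢s : bits (removeEdge U e) ≢ bits s
      U-e≢s eq = ∉-removeEdge U e (trans (cong (λ v → lookup v e) eq) bit)
    ... | false = begin
      σ s * (x * δ U (addEdge s e))     ≡⟨ cong (λ d → σ s * (x * d)) (δ-addEdge U s e e∈U ((λ ()) ∘ trans (sym bit))) ⟩
      σ s * (x * d)                     ≡⟨ rearrange (σ s) x d ⟩
      d * (σ s * x)                     ≡⟨ δ-transport (λ t → σ t * x) (removeEdge U e) s ⟨
      d * (σ (removeEdge U e) * x)      ∎
      where
      open ≡-Reasoning
      σ : Face k → ℤ
      σ t = sgn (before t e)
      d : ℤ
      d = δ (removeEdge U e) s
      rearrange : ∀ a b c → a * (b * c) ≡ c * (a * b)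
      rearrange = ℤ-Solver.solve-∀

    ∂-summand-face-≢0 : (s : Face k) (e : Edge k) → ∂-summand (λ t → x * δ U t) s e ≢ + 0 →
                        In U e × s ⊆ removeEdge U e
    ∂-summand-face-≢0 s e summand≢0 with lookup (bits s) e in bit
    ... | true  = ⊥-elim (summand≢0 refl)
    ... | false = subst (λ v → lookup v e ≡ true) (sym U≡s+e) (Vecₚ.lookup∘update e (bits s) true) , s⊆U-e
      where
      U≡s+e : bits U ≡ bits (addEdge s e)
      U≡s+e = δ-≢0 U (addEdge s e) (i*j≢0⇒j≢0 x _ (i*j≢0⇒j≢0 (sgn (before s e)) _ summand≢0))
      s⊆U-e : s ⊆ removeEdge U e
      s⊆U-e {e′} e′∈ = ∈-removeEdge⁺ U e
        (trans (cong (λ v → lookup v e′) U≡s+e) (trans (Vecₚ.lookup∘update′ e′≢e (bits s) true) e′∈)) e′≢e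
        where
        e′≢e : e′ ≢ e
        e′≢e refl with trans (sym bit) e′∈
        ... | ()

-- Exchanging an edge of a tree

record Fork {k : ℕ} (T : Face k) (r : Fin k) : Set where
  field
    {p q}    : Fin k
    e₁ e₂ e₃ : Edge k
    e₁∈T     : In T e₁
    e₂∈T     : In T e₂
    ends-e₁  : ends e₁ ≡ (r , p)
    ends-e₂  : ends e₂ ≡ (r , q)
    e₃-links : Links e₃ p q
    e₁≢e₂    : e₁ ≢ e₂

Fork-swap : {T : Face k} {r : Fin k} → Fork T r → Fork T r
Fork-swap F = record
  { e₁ = e₂ ; e₂ = e₁ ; e₃ = e₃ ; e₁∈T = e₂∈T ; e₂∈T = e₁∈T ; ends-e₁ = ends-e₂ ; ends-e₂ = ends-e₁
  ; e₃-links = Links-sym e₃-links ; e₁≢e₂ = e₁≢e₂ ∘ sym }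
  where open Fork F

module Exchange {k : ℕ} {T : Face k} {r : Fin k} (tree : Tree T) (F : Fork T r) where
  open Fork F

  U T′ : Face k
  U  = addEdge T e₃
  T′ = removeEdge U e₁

  private
    acyclic : Acyclic T
    acyclic = proj₂ tree

    p≢r : p ≢ r
    p≢r refl = Finₚ.<-irrefl refl (subst (λ x → proj₁ x Fin.< proj₂ x) ends-e₁ (ends-< {k} e₁))

    q≢r : q ≢ r
    q≢r refl = Finₚ.<-irrefl refl (subst (λ x → proj₁ x Fin.< proj₂ x) ends-e₂ (ends-< {k} e₂))

    e₃-away : ∀ {e x} → ends e ≡ (r , x) → e₃ ≢ e
    e₃-away eq refl = Sum.[ p≢r ∘ sym , q≢r ∘ sym ] (Links-endpoint e₃-links (inj₁ eq))

    p~q : ∀ {G} → In G e₁ → In G e₂ → Reach G p q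
    p~q e₁∈ e₂∈ = step (e₁ , e₁∈ , inj₂ ends-e₁) (step (e₂ , e₂∈ , inj₁ ends-e₂) here)

    ∈-T : ∀ {e} → In U e → e ≢ e₃ → In T e
    ∈-T e∈U e≢e₃ = Sum.[ id , ⊥-elim ∘ e≢e₃ ] (∈-addEdge⁻ T e₃ e∈U)

  e₃≢e₁ : e₃ ≢ e₁
  e₃≢e₁ = e₃-away ends-e₁

  e₃≢e₂ : e₃ ≢ e₂
  e₃≢e₂ = e₃-away ends-e₂

  e₃∉T : ¬ In T e₃
  e₃∉T e₃∈T = Acyclic⇒bridge acyclic e₃∈T e₃-links
    (p~q (∈-removeEdge⁺ T e₃ e₁∈T (e₃≢e₁ ∘ sym)) (∈-removeEdge⁺ T e₃ e₂∈T (e₃≢e₂ ∘ sym)))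

  removeEdge-e₃ : bits (removeEdge U e₃) ≡ bits T
  removeEdge-e₃ = removeEdge-addEdge T e₃ e₃∉T

  e₁∈U : In U e₁
  e₁∈U = ∈-addEdge⁺ T e₃ e₁∈T

  e₂∈U : In U e₂
  e₂∈U = ∈-addEdge⁺ T e₃ e₂∈T

  size-U : size U ≡ suc (size T)
  size-U = size-addEdge T e₃ e₃∉T

  U-connected : Connected U
  U-connected i j = Reach-mono (∈-addEdge⁺ T e₃) (proj₁ tree i j)

  private
    U-bridge : ∀ {e a b} → In T e → Links e a b → e ≢ e₁ → e ≢ e₂ → ¬ Reach (removeEdge U e) a b
    U-bridge {e} e∈T lk e≢e₁ e≢e₂ =
      Acyclic⇒bridge acyclic e∈T lk ∘
      Reach-bypass U-e⊆T-e+e₃ e₃-links (p~q (∈-removeEdge⁺ T e e₁∈T (e≢e₁ ∘ sym)) (∈-removeEdge⁺ T e e₂∈T (e≢e₂ ∘ sym)))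
      where
      U-e⊆T-e+e₃ : removeEdge U e ⊆ addEdge (removeEdge T e) e₃
      U-e⊆T-e+e₃ e′∈ with ∈-removeEdge⁻ U e e′∈
      ... | e′∈U , e′≢e with ∈-addEdge⁻ T e₃ e′∈U
      ...   | inj₁ e′∈T = ∈-addEdge⁺ (removeEdge T e) e₃ (∈-removeEdge⁺ T e e′∈T e′≢e)
      ...   | inj₂ refl = ∈-addEdge (removeEdge T e) e₃

    T′-e₃-bridge : ¬ Reach (removeEdge T′ e₃) p q
    T′-e₃-bridge p~q′ = Acyclic⇒bridge acyclic e₁∈T (inj₁ ends-e₁)
      (step (e₂ , ∈-removeEdge⁺ T e₁ e₂∈T (e₁≢e₂ ∘ sym) , inj₁ ends-e₂) (Reach-sym (Reach-mono T′-e₃⊆T-e₁ p~q′)))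
      where
      T′-e₃⊆T-e₁ : removeEdge T′ e₃ ⊆ removeEdge T e₁
      T′-e₃⊆T-e₁ e′∈ with ∈-removeEdge⁻ T′ e₃ e′∈
      ... | e′∈T′ , e′≢e₃ with ∈-removeEdge⁻ U e₁ e′∈T′
      ...   | e′∈U , e′≢e₁ = ∈-removeEdge⁺ T e₁ (∈-T e′∈U e′≢e₃) e′≢e₁

    T′-e₂-bridge : ¬ Reach (removeEdge T′ e₂) r q
    T′-e₂-bridge r~q = Sum.[ T-e₂-bridge , Sum.[ T-e₁-bridge , T-e₂-bridge ] ]
                         (Reach-addEdge⁻ {G = G} T′-e₂⊆G+e₃ e₃-links r~q)
      where
      G : Face k
      G = removeEdge (removeEdge T e₁) e₂
      T-e₁-bridge : ¬ Reach G r p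
      T-e₁-bridge = Acyclic⇒bridge acyclic e₁∈T (inj₁ ends-e₁) ∘ Reach-mono (removeEdge-⊆ (removeEdge T e₁) e₂)
      T-e₂-bridge : ¬ Reach G r q
      T-e₂-bridge = Acyclic⇒bridge acyclic e₂∈T (inj₁ ends-e₂) ∘ Reach-mono G⊆T-e₂
        where
        G⊆T-e₂ : G ⊆ removeEdge T e₂
        G⊆T-e₂ e′∈ with ∈-removeEdge⁻ (removeEdge T e₁) e₂ e′∈
        ... | e′∈T-e₁ , e′≢e₂ = ∈-removeEdge⁺ T e₂ (removeEdge-⊆ T e₁ e′∈T-e₁) e′≢e₂
      T′-e₂⊆G+e₃ : removeEdge T′ e₂ ⊆ addEdge G e₃
      T′-e₂⊆G+e₃ {e′} e′∈ with ∈-removeEdge⁻ T′ e₂ e′∈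
      ... | e′∈T′ , e′≢e₂ with ∈-removeEdge⁻ U e₁ e′∈T′
      ...   | e′∈U , e′≢e₁ with e′ ≟ e₃
      ...     | yes refl = ∈-addEdge G e₃
      ...     | no e′≢e₃ = ∈-addEdge⁺ G e₃ (∈-removeEdge⁺ (removeEdge T e₁) e₂ (∈-removeEdge⁺ T e₁ (∈-T e′∈U e′≢e₃) e′≢e₁) e′≢e₂)

  removeEdge-disconnects : ∀ {e} → In U e → e ≢ e₃ → e ≢ e₁ → e ≢ e₂ → ¬ Connected (removeEdge U e)
  removeEdge-disconnects e∈U e≢e₃ e≢e₁ e≢e₂ connected = U-bridge (∈-T e∈U e≢e₃) (inj₁ refl) e≢e₁ e≢e₂ (connected _ _)

  T′-connected : Connected T′
  T′-connected i j = Reach-bypass T⊆T′+e₁ (inj₁ ends-e₁) r~p (proj₁ tree i j)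
    where
    T⊆T′+e₁ : T ⊆ addEdge T′ e₁
    T⊆T′+e₁ {e} e∈T with e ≟ e₁
    ... | yes refl = ∈-addEdge T′ e₁
    ... | no e≢e₁  = ∈-addEdge⁺ T′ e₁ (∈-removeEdge⁺ U e₁ (∈-addEdge⁺ T e₃ e∈T) e≢e₁)
    r~p : Reach T′ r p
    r~p = step (e₂ , ∈-removeEdge⁺ U e₁ e₂∈U (e₁≢e₂ ∘ sym) , inj₁ ends-e₂)
               (step (e₃ , ∈-removeEdge⁺ U e₁ (∈-addEdge T e₃) e₃≢e₁ , Links-sym e₃-links) here)

  T′-acyclic : Acyclic T′
  T′-acyclic cycle with HasCycle⇒Redundant cycle
  ... | e , e∈T′ , joined with ∈-removeEdge⁻ U e₁ e∈T′ | e ≟ e₃ | e ≟ e₂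
  ... | _          | yes refl | _        = T′-e₃-bridge (Links-reach (inj₁ refl) e₃-links joined)
  ... | _          | no _     | yes refl = T′-e₂-bridge (Links-reach (inj₁ refl) (inj₁ ends-e₂) joined)
  ... | e∈U , e≢e₁ | no e≢e₃  | no e≢e₂  =
    U-bridge (∈-T e∈U e≢e₃) (inj₁ refl) e≢e₁ e≢e₂ (Reach-mono (removeEdge-mono {s = T′} {t = U} (removeEdge-⊆ U e₁) e) joined)

  T′-tree : Tree T′
  T′-tree = T′-connected , T′-acyclic

  size-T′ : size T′ ≡ size T
  size-T′ = ℕₚ.suc-injective (trans (size-removeEdge U e₁ e₁∈U) size-U)

  degree-T′ : suc (degree T′ r) ≡ degree T r
  degree-T′ = trans (degree-removeEdge U e₁ e₁∈U (incident-here (cong proj₁ ends-e₁)))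
                    (degree-addEdge T e₃ (incident-away e₃-links p≢r q≢r))

module _ {m : ℕ} {r : Fin (suc m)} (r-least : ∀ {j : Fin (suc m)} → ¬ j Fin.< r) where

  ends-least : {e : Edge (suc m)} → proj₁ (ends e) ≡ r ⊎ proj₂ (ends e) ≡ r →
               ∃ λ (j : Fin (suc m)) → ends e ≡ (r , j)
  ends-least {e} (inj₁ eq) = proj₂ (ends e) , cong (_, proj₂ (ends e)) eq
  ends-least {e} (inj₂ eq) = ⊥-elim (r-least (subst (proj₁ (ends e) Fin.<_) eq (ends-< {suc m} e)))

  edge-at-least : (T : Face (suc m)) {w : Fin (suc m)} → w ≢ r → Connected T →
                  ∃ λ e → In T e × ∃ λ (p : Fin (suc m)) → ends e ≡ (r , p)
  edge-at-least T {w} w≢r connected = first-step (connected r w)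
    where
    first-step : Reach T r w → ∃ λ e → In T e × ∃ λ (p : Fin (suc m)) → ends e ≡ (r , p)
    first-step here                        = ⊥-elim (w≢r refl)
    first-step (step (e , e∈ , inj₁ eq) _) = e , e∈ , ends-least {e} (inj₁ (cong proj₁ eq))
    first-step (step (e , e∈ , inj₂ eq) _) = e , e∈ , ends-least {e} (inj₂ (cong proj₂ eq))

  another-edge-at-least : (T : Face (suc m)) {e₁ : Edge (suc m)} {p : Fin (suc m)} → In T e₁ → ends e₁ ≡ (r , p) →
    degree T r ≢ 1 → ∃ λ e₂ → In T e₂ × e₂ ≢ e₁ × ∃ λ (q : Fin (suc m)) → ends e₂ ≡ (r , q)
  another-edge-at-least T {e₁} e₁∈ ends-e₁ deg≢1 = pick (incident-edge (removeEdge T e₁) r deg′≢0)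
    where
    deg′≢0 : degree (removeEdge T e₁) r ≢ 0
    deg′≢0 deg≡0 = deg≢1 (trans (sym (degree-removeEdge T e₁ e₁∈ (incident-here (cong proj₁ ends-e₁)))) (cong suc deg≡0))
    pick : (∃ λ e₂ → In (removeEdge T e₁) e₂ × (proj₁ (ends e₂) ≡ r ⊎ proj₂ (ends e₂) ≡ r)) →
           ∃ λ e₂ → In T e₂ × e₂ ≢ e₁ × ∃ λ (q : Fin (suc m)) → ends e₂ ≡ (r , q)
    pick (e₂ , e₂∈ , at-r) = e₂ , proj₁ (∈-removeEdge⁻ T e₁ e₂∈) , proj₂ (∈-removeEdge⁻ T e₁ e₂∈) , ends-least {e₂} at-r

  -- Matched through helper functions: with-abstraction over these types is prohibitively slow.
  fork-at-least : (T : Face (suc m)) {w : Fin (suc m)} → w ≢ r → Connected T → degree T r ≢ 1 → Fork T r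
  fork-at-least T w≢r connected deg≢1 = from-e₁ (edge-at-least T w≢r connected)
    where
    from-e₁ : (∃ λ e₁ → In T e₁ × ∃ λ (p : Fin (suc m)) → ends e₁ ≡ (r , p)) → Fork T r
    from-e₁ (e₁ , e₁∈ , p , ends-e₁) = from-e₂ (another-edge-at-least T e₁∈ ends-e₁ deg≢1)
      where
      from-e₂ : (∃ λ e₂ → In T e₂ × e₂ ≢ e₁ × ∃ λ (q : Fin (suc m)) → ends e₂ ≡ (r , q)) → Fork T r
      from-e₂ (e₂ , e₂∈ , e₂≢e₁ , q , ends-e₂) = record
        { e₁ = e₁ ; e₂ = e₂ ; e₃ = proj₁ closing ; e₁∈T = e₁∈ ; e₂∈T = e₂∈ ; ends-e₁ = ends-e₁ ; ends-e₂ = ends-e₂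
        ; e₃-links = proj₂ closing ; e₁≢e₂ = e₂≢e₁ ∘ sym }
        where
        closing : ∃ λ e₃ → Links e₃ p q
        closing = edge-linking λ { refl → e₂≢e₁ (ends-injective {suc m} (trans ends-e₂ (sym ends-e₁))) }

-- Reduction to normed trees

HomologousToNormed : {m : ℕ} → Fin (suc m) → Face (suc m) → ℤ → Set
HomologousToNormed {m} r T ε =
  Σ (Chain (suc m)) λ lam →
  Σ (Chain (suc m)) λ c →
    ((s : Face (suc m)) → lam s ≢ + 0 → NormedTree r s) ×
    ((t : Face (suc m)) → c t ≢ + 0 → Connected t × size t ≡ suc m) ×
    ((s : Face (suc m)) → Connected s → size s ≡ m → ε * δ T s - lam s ≡ ∂ c s)

module _ {m : ℕ} {r : Fin (suc m)} where

  wrong-size : (T : Face (suc m)) → size T ≢ m → (ε : ℤ) → HomologousToNormed r T ε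
  wrong-size T size≢ ε = (λ _ → + 0) , (λ _ → + 0) , (λ _ 0≢0 → ⊥-elim (0≢0 refl)) , (λ _ 0≢0 → ⊥-elim (0≢0 refl)) ,
    λ s _ size-s → begin
      ε * δ T s - + 0   ≡⟨ cong (λ d → ε * d - + 0) (δ-≢ T s λ eq → size≢ (trans (cong (λ v → size {suc m} (face v)) eq) size-s)) ⟩
      ε * + 0 - + 0     ≡⟨ trans (ℤₚ.+-identityʳ _) (ℤₚ.*-zeroʳ ε) ⟩
      + 0               ≡⟨ ∂-zero s ⟨
      ∂ (λ _ → + 0) s   ∎
    where open ≡-Reasoning

  normed : (T : Face (suc m)) → NormedTree r T → (ε : ℤ) → HomologousToNormed r T ε
  normed T normedT ε = (λ s → ε * δ T s) , (λ _ → + 0) , lam-normed , (λ _ 0≢0 → ⊥-elim (0≢0 refl)) ,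
    λ s _ _ → trans (ℤₚ.+-inverseʳ (ε * δ T s)) (sym (∂-zero s))
    where
    lam-normed : (s : Face (suc m)) → ε * δ T s ≢ + 0 → NormedTree r s
    lam-normed s εδ≢0 = subst (NormedTree r) (cong face (δ-≢0 T s (i*j≢0⇒j≢0 ε (δ T s) εδ≢0))) normedT

module ExchangeStep {m : ℕ} {r : Fin (suc m)} {T : Face (suc m)} (tree : Tree T) (size-T : size T ≡ m)
                    (F : Fork T r) (ε : ℤ) where
  open Fork F
  module X₁ = Exchange tree F
  module X₂ = Exchange tree (Fork-swap F)
  open X₁ using (U)
  open ≡-Reasoning

  T₁ T₂ : Face (suc m)
  T₁ = X₁.T′
  T₂ = X₂.T′

  -- The coefficient x of U is chosen so that T occurs in ∂(x·U) with coefficient ε; the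
  -- coefficients a₁, a₂ of T₁, T₂ are then cancelled by the induction hypothesis.
  σ₀ x a₁ a₂ : ℤ
  σ₀ = sgn (before (removeEdge U e₃) e₃)
  x  = σ₀ * ε
  a₁ = sgn (before T₁ e₁) * x
  a₂ = sgn (before T₂ e₂) * x

  c₀ : Chain (suc m)
  c₀ t = x * δ U t

  c₀-support : (t : Face (suc m)) → c₀ t ≢ + 0 → Connected t × size t ≡ suc m
  c₀-support t c₀≢0 = subst (λ t → Connected t × size t ≡ suc m) (cong face U≡t)
                            (X₁.U-connected , trans X₁.size-U (cong suc size-T))
    where
    U≡t : bits U ≡ bits t
    U≡t = δ-≢0 U t (i*j≢0⇒j≢0 x (δ U t) c₀≢0)

  ∂c₀ : ∀ s → Connected s → ∂ c₀ s ≡ δ T s * ε + (δ T₁ s * a₁ + δ T₂ s * a₂)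
  ∂c₀ s connected = begin
    ∂ c₀ s
      ≡⟨ ΣFinℤ-support₃ (∂-summand c₀ s) (X₁.e₃≢e₁ ∘ sym) (X₁.e₃≢e₂ ∘ sym) (e₁≢e₂ ∘ sym) off-cycle ⟩
    ∂-summand c₀ s e₃ + (∂-summand c₀ s e₁ + ∂-summand c₀ s e₂)
      ≡⟨ cong₂ _+_ (∂-summand-face U x e₃ (∈-addEdge T e₃) s)
                   (cong₂ _+_ (∂-summand-face U x e₁ X₁.e₁∈U s) (∂-summand-face U x e₂ X₁.e₂∈U s)) ⟩
    δ (removeEdge U e₃) s * (σ₀ * x) + (δ T₁ s * a₁ + δ T₂ s * a₂)
      ≡⟨ cong₂ (λ d y → d * y + (δ T₁ s * a₁ + δ T₂ s * a₂)) (cong (λ v → δ (face v) s) X₁.removeEdge-e₃) σ₀x≡ε ⟩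
    δ T s * ε + (δ T₁ s * a₁ + δ T₂ s * a₂) ∎
    where
    σ₀x≡ε : σ₀ * x ≡ ε
    σ₀x≡ε = trans (sym (ℤₚ.*-assoc σ₀ σ₀ ε)) (trans (cong (_* ε) (sgn-involutive (before (removeEdge U e₃) e₃))) (ℤₚ.*-identityˡ ε))
    off-cycle : ∀ e → e ≢ e₃ → e ≢ e₁ → e ≢ e₂ → ∂-summand c₀ s e ≡ + 0
    off-cycle e e≢e₃ e≢e₁ e≢e₂ = decidable-stable (∂-summand c₀ s e Data.Integer.≟ + 0) λ summand≢0 →
      let e∈U , s⊆U-e = ∂-summand-face-≢0 U x s e summand≢0 in
      X₁.removeEdge-disconnects e∈U e≢e₃ e≢e₁ e≢e₂ λ i j → Reach-mono s⊆U-e (connected i j)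

  combine : HomologousToNormed r T₁ (- a₁) → HomologousToNormed r T₂ (- a₂) → HomologousToNormed r T ε
  combine (lam₁ , c₁ , normed₁ , support₁ , boundary₁) (lam₂ , c₂ , normed₂ , support₂ , boundary₂) =
    lam , c , lam-normed , c-support , boundary
    where
    lam c : Chain (suc m)
    lam s = lam₁ s + lam₂ s
    c t = c₀ t + c₁ t + c₂ t

    lam-normed : (s : Face (suc m)) → lam s ≢ + 0 → NormedTree r s
    lam-normed s = Sum.[ normed₁ s , normed₂ s ] ∘ i+j≢0⇒i≢0⊎j≢0 (lam₁ s) (lam₂ s)

    c-support : (t : Face (suc m)) → c t ≢ + 0 → Connected t × size t ≡ suc m
    c-support t = Sum.[ Sum.[ c₀-support t , support₁ t ] ∘ i+j≢0⇒i≢0⊎j≢0 (c₀ t) (c₁ t) , support₂ t ]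
                  ∘ i+j≢0⇒i≢0⊎j≢0 (c₀ t + c₁ t) (c₂ t)

    boundary : (s : Face (suc m)) → Connected s → size s ≡ m → ε * δ T s - lam s ≡ ∂ c s
    boundary s connected size-s = begin
      ε * δ T s - (lam₁ s + lam₂ s)
        ≡⟨ regroup ε (δ T s) (δ T₁ s) (δ T₂ s) a₁ a₂ (lam₁ s) (lam₂ s) ⟩
      (δ T s * ε + (δ T₁ s * a₁ + δ T₂ s * a₂)) + (- a₁ * δ T₁ s - lam₁ s) + (- a₂ * δ T₂ s - lam₂ s)
        ≡⟨ cong₂ _+_ (cong₂ _+_ (sym (∂c₀ s connected)) (boundary₁ s connected size-s)) (boundary₂ s connected size-s) ⟩
      ∂ c₀ s + ∂ c₁ s + ∂ c₂ s
        ≡⟨ trans (∂-+ (λ t → c₀ t + c₁ t) c₂ s) (cong (_+ ∂ c₂ s) (∂-+ c₀ c₁ s)) ⟨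
      ∂ c s ∎
      where
      regroup : ∀ ε d d₁ d₂ a₁ a₂ l₁ l₂ →
        ε * d - (l₁ + l₂) ≡ (d * ε + (d₁ * a₁ + d₂ * a₂)) + (- a₁ * d₁ - l₁) + (- a₂ * d₂ - l₂)
      regroup = ℤ-Solver.solve-∀

  exchange-step : (∀ T′ → Tree T′ → size T′ ≡ m → suc (degree T′ r) ≡ degree T r → ∀ ε′ → HomologousToNormed r T′ ε′) →
                  HomologousToNormed r T ε
  exchange-step IH = combine (IH T₁ X₁.T′-tree (trans X₁.size-T′ size-T) X₁.degree-T′ (- a₁))
                             (IH T₂ X₂.T′-tree (trans X₂.size-T′ size-T) X₂.degree-T′ (- a₂))

module _ {m : ℕ} {r : Fin (suc m)} where

  normalise : (∀ {j : Fin (suc m)} → ¬ j Fin.< r) → {w : Fin (suc m)} → w ≢ r →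
              (d : ℕ) (T : Face (suc m)) → Tree T → size T ≡ m → degree T r ≤ d → (ε : ℤ) → HomologousToNormed r T ε
  normalise r-least w≢r d T tree size-T deg≤d ε = by-degree (degree T r ℕ.≟ 1)
    where
    smaller : ∀ d → degree T r ≤ d → ∀ T′ → Tree T′ → size T′ ≡ m →
              suc (degree T′ r) ≡ degree T r → ∀ ε′ → HomologousToNormed r T′ ε′
    smaller zero    deg≤0 T′ _     _     deg′ = ⊥-elim (ℕₚ.n≮0 (subst (_≤ 0) (sym deg′) deg≤0))
    smaller (suc d) deg≤  T′ tree′ size′ deg′ =
      normalise r-least w≢r d T′ tree′ size′ (ℕₚ.≤-pred (subst (_≤ suc d) (sym deg′) deg≤))
    by-degree : Dec (degree T r ≡ 1) → HomologousToNormed r T ε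
    by-degree (yes deg≡1) = normed T (tree , deg≡1) ε
    by-degree (no deg≢1)  =
      ExchangeStep.exchange-step tree size-T (fork-at-least r-least T w≢r (proj₁ tree) deg≢1) ε (smaller d deg≤d)

lemma4 : (n : ℕ) → (T : Face (suc (suc n))) → Tree T →
    (ε : ℤ) → (ε ≡ + 1 ⊎ ε ≡ - (+ 1)) →
    Σ (Chain (suc (suc n))) λ lam →
    Σ (Chain (suc (suc n))) λ c →
      ((s : Face (suc (suc n))) → lam s ≢ + 0 → NormedTree zero s) ×
      ((t : Face (suc (suc n))) → c t ≢ + 0 → Connected t × size t ≡ suc (suc n)) ×
      ((s : Face (suc (suc n))) → Connected s → size s ≡ suc (suc n) ∸ 1 →
        ε * δ T s - lam s ≡ ∂ c s)
-- δ T vanishes on faces with k − 1 edges unless T has k − 1 edges itself.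
lemma4 n T tree ε _ = by-size (size T ℕ.≟ suc n)
  where
  by-size : Dec (size T ≡ suc n) → HomologousToNormed zero T ε
  by-size (yes size-T) = normalise (λ ()) {suc zero} (λ ()) (degree T zero) T tree size-T ℕₚ.≤-refl ε
  by-size (no size≢)   = wrong-size T size≢ ε
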